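{- Let $N=p_1\cdots p_n$ be a product of $n\ge1$ distinct primes and let $p$ be a prime not dividing $N$. For $T\subseteq[n]$ write $N_T=\sum_{i\in T}N_i$, and for an integer $k$ let $m_k=p^{ -1}\bigl(k-N\langle kN^{ -1}\rangle_p\bigr)$ (an integer). Then for every integer $k$, $$a_{pN}(k)-a_{pN}(k-pN)=\sum_{T\subseteq[n]}(-1)^{|T|}a_N(m_{k-N_T}).$$
   Context: For a squarefree $M=q_1\cdots q_m$ ($m\ge1$ distinct primes) write $M_{i_1\cdots i_r}=M/(q_{i_1}\cdots q_{i_r})$ and $P_M(x)=\frac{(1-x^M)\prod_{1\le i<j\le m}(1-x^{M_{ij}})}{\prod_{i=1}^m(1-x^{M_i})}$. $a_M(k)$ is the coefficient of $x^k$ in $P_M(x)$, with $a_M(k)=0$ for $k<0$. $N_i=N/p_i$. For a rational $c=a/b$ with $b$ coprime to $m$, $\langle c\rangle_m$ is the smallest nonnegative integer $k$ with $kb\equiv a\pmod m$. -}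

module Defs where

open import Data.Bool using (Bool; true; false; if_then_else_)
open import Data.Nat as ℕ using (ℕ; zero; suc; _≤ᵇ_; _<ᵇ_; _≡ᵇ_)
open import Data.Integer as ℤ using (ℤ; +_; -[1+_]; _-_; _/ℕ_; _%ℕ_)
import Data.Integer.Properties
open import Data.Fin using (Fin; toℕ)
open import Data.Fin.Subset using (Subset; ∣_∣)
open import Data.Vec as Vec using (Vec; []; _∷_; lookup)
open import Data.List as List using (List; []; _∷_; map; filter; foldr; allFin; upTo; concatMap; _++_)
open import Data.Nat.ListAction using (product)
open import Data.Product using (_×_; _,_)
open import Relation.Nullary using (¬?)
open import Relation.Nullary.Decidable using (⌊_⌋)
open import Data.Fin using (_≟_)
open import Relation.Unary using (Decidable)

-- Formal power series with integer coefficients: coefficient functions.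
Series : Set
Series = ℕ → ℤ

oneS : Series
oneS zero    = ℤ.+ 1
oneS (suc _) = ℤ.+ 0

mulOneMinus : ℕ → Series → Series
mulOneMinus a c k = c k - (if a ≤ᵇ k then c (k ℕ.∸ a) else ℤ.+ 0)

-- division by (1 - x^a), a ≥ 1: multiplication by ∑_{j≥0} x^{ja},
-- i.e. coefficient k is ∑_{j ≥ 0, ja ≤ k} c (k - ja)
divOneMinus : ℕ → Series → Series
divOneMinus a c k =
  foldr ℤ._+_ (ℤ.+ 0)
    (map (λ j → if (j ℕ.* a) ≤ᵇ k then c (k ℕ.∸ (j ℕ.* a)) else ℤ.+ 0) (upTo (suc k)))

-- A squarefree M = q_0 ⋯ q_{m-1} is given by its family of primes q : Fin m → ℕ.
prodℕ : List ℕ → ℕ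
prodℕ = product

bigM : ∀ {m} → (Fin m → ℕ) → ℕ
bigM {m} q = prodℕ (map q (allFin m))

bigMi : ∀ {m} → (Fin m → ℕ) → Fin m → ℕ
bigMi {m} q i = prodℕ (map q (filter (λ k → ¬? (k ≟ i)) (allFin m)))

bigMij : ∀ {m} → (Fin m → ℕ) → Fin m → Fin m → ℕ
bigMij {m} q i j =
  prodℕ (map q (filter (λ k → ¬? (k ≟ j)) (filter (λ k → ¬? (k ≟ i)) (allFin m))))

pairsLt : ∀ m → List (Fin m × Fin m)
pairsLt m = concatMap (λ i → concatMap (λ j → if toℕ i <ᵇ toℕ j then (i , j) ∷ [] else []) (allFin m)) (allFin m)

-- P_M(x) = (1 - x^M) ∏_{i<j} (1 - x^{M_ij}) / ∏_i (1 - x^{M_i}), as a power series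
seriesP : ∀ {m} → (Fin m → ℕ) → Series
seriesP {m} q =
  foldr (λ i s → divOneMinus (bigMi q i) s)
    (foldr (λ ij s → mulOneMinus (bigMij q (Data.Product.proj₁ ij) (Data.Product.proj₂ ij)) s)
      (mulOneMinus (bigM q) oneS)
      (pairsLt m))
    (allFin m)

coeffA : ∀ {m} → (Fin m → ℕ) → ℤ → ℤ
coeffA q (+ k)      = seriesP q k
coeffA q -[1+ _ ]   = ℤ.+ 0

-- ⟨ a / b ⟩_p : least nonnegative r with r b ≡ a (mod p).
-- Searched among r < p (a solution exists there whenever gcd(b,p)=1);
-- returns 0 if none is found (never happens under the standing hypotheses).
divides? : ℤ → ℕ → Bool
divides? x zero    = false
divides? x (suc d) = (x %ℕ suc d) ≡ᵇ 0

firstIn : (ℕ → Bool) → List ℕ → ℕ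
firstIn P []       = 0
firstIn P (r ∷ rs) = if P r then r else firstIn P rs

bracket : ℤ → ℕ → ℕ → ℕ
bracket a b p = firstIn (λ r → divides? ((ℤ.+ r) ℤ.* (ℤ.+ b) - a) p) (upTo p)

divExact : ℤ → ℕ → ℤ
divExact x zero    = ℤ.+ 0
divExact x (suc d) = x /ℕ suc d

mK : ℕ → ℕ → ℤ → ℤ
mK p N k = divExact (k - (ℤ.+ N) ℤ.* (ℤ.+ bracket k N p)) p

allSubsets : ∀ n → List (Subset n)
allSubsets zero    = Vec.[] ∷ []
allSubsets (suc n) = map (true Vec.∷_) (allSubsets n) ++ map (false Vec.∷_) (allSubsets n)

bigNT : ∀ {n} → (Fin n → ℕ) → Subset n → ℕ
bigNT {n} ps T = foldr ℕ._+_ 0 (map (bigMi ps) (filter (λ i → Data.Bool._≟_ (lookup T i) true) (allFin n)))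

signPow : ℕ → ℤ
signPow zero    = ℤ.+ 1
signPow (suc r) = ℤ.- signPow r

sumℤ : List ℤ → ℤ
sumℤ = foldr ℤ._+_ (ℤ.+ 0)

{-# OPTIONS --safe #-}

-- Write N = ∏ ps. The exponents of P_{pN} are M = pN, M_0 = N, M_i = pN_i, M_{0j} = N_j and
-- M_{ij} = pN_{ij}; all factors except 1 - x^N and the 1 - x^{N_j} are functions of x^p, and
--     (1 - x^N) P_{pN}(x) = ∏_j (1 - x^{N_j}) · P_N(x^p).
-- Sum the coefficients of x^{k - rN} over 0 ≤ r < p on both sides. On the left the sum telescopes
-- to a_{pN}(k) - a_{pN}(k - pN). On the right the product expands, by inclusion–exclusion, into
-- ∑_T (-1)^{|T|} times the same sum for P_N(x^p) at k′ = k - N_T. As p ∤ N, exactly one of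
-- k′, k′ - N, …, k′ - (p-1)N is divisible by p, namely k′ - N⟨k′N⁻¹⟩_p = p m_{k′}, so that sum
-- is a_N(m_{k′}).
--
-- Identities are proved after
-- extending coefficients by zero to ℤ (coeffℤ), where 1 - x^a acts as the difference operator ∇ a;
-- P(x) ↦ P(x^p) is stretch p.

module Submission where

open import Defs
open import Data.Bool as Bool using (Bool; true; false; if_then_else_; T)
open import Data.List.Membership.Propositional using (_∈_)
open import Data.List.Membership.Propositional.Properties using (∈-upTo⁺; ∈-upTo⁻)
open import Data.List.Relation.Unary.Any using (here; there)
open import Data.Fin using (Fin; zero; suc; toℕ; _≟_)
open import Data.Fin.Subset using (Subset; ∣_∣)
open import Data.Integer as ℤ using (ℤ; +_; -[1+_]; _+_; _-_; _*_; -_; _%ℕ_; _/ℕ_; _⊖_)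
import Data.Integer.Properties as ℤ
open import Data.Integer.DivMod using (a≡a%ℕn+[a/ℕn]*n; n%ℕd<d)
open import Data.Integer.Divisibility.Signed as ℤ∣ using (divides; _∣?_) renaming (_∣_ to _∣ℤ_)
open import Data.Integer.Tactic.RingSolver using (solve-∀)
open import Data.List as List using (List; []; map; foldr; filter; allFin; upTo; concat; concatMap; _++_)
import Data.List.Properties as List
open import Data.Nat as ℕ using (ℕ; zero; suc; NonZero; _≤_; _<_; z≤n; s≤s; _≤ᵇ_)
import Data.Nat.Properties as ℕ
import Data.Nat.DivMod as ℕ
open import Data.Nat.Coprimality using (Coprime; coprime-Bézout; coprime-divisor)
open import Data.Nat.Divisibility using (_∣_; >⇒∤)
open import Data.Nat.GCD using (module Bézout)
open import Data.Nat.Primality using (Prime; prime⇒irreducible; prime⇒nonZero)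
open import Data.Nat.Induction using (<-rec)
open import Data.Product as Product using (_×_; _,_; proj₁; proj₂; ∃-syntax)
open import Data.Sum using (inj₁; inj₂)
open import Data.Vec as Vec using (lookup)
open import Data.Vec.Functional using (_∷_)
open import Function using (_∘_; it; Injective)
open import Relation.Binary.PropositionalEquality
open import Relation.Nullary using (Dec; ¬_; ¬?; yes; no; does; contradiction)
open import Relation.Nullary.Decidable using (dec-true; dec-false)

open ≡-Reasoning

m-n+n≡m : ∀ m n → m - n + n ≡ m
m-n+n≡m = solve-∀

m+n-n≡m : ∀ m n → m + n - n ≡ m
m+n-n≡m = solve-∀

sumℤ-++ : ∀ xs ys → sumℤ (xs ++ ys) ≡ sumℤ xs + sumℤ ys
sumℤ-++ []       ys = sym (ℤ.+-identityˡ (sumℤ ys))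
sumℤ-++ (x List.∷ xs) ys = trans (cong (_+_ x) (sumℤ-++ xs ys)) (sym (ℤ.+-assoc x (sumℤ xs) (sumℤ ys)))

sumℤ-map-cong : ∀ {A : Set} {f g : A → ℤ} → f ≗ g → ∀ xs → sumℤ (map f xs) ≡ sumℤ (map g xs)
sumℤ-map-cong f≗g xs = cong sumℤ (List.map-cong f≗g xs)

sumℤ-map-neg : ∀ {A : Set} (f : A → ℤ) xs → sumℤ (map (λ x → - f x) xs) ≡ - sumℤ (map f xs)
sumℤ-map-neg f []       = refl
sumℤ-map-neg f (x List.∷ xs) = trans (cong (_+_ (- f x)) (sumℤ-map-neg f xs)) (sym (ℤ.neg-distrib-+ (f x) _))

sumℤ-map-- : ∀ {A : Set} (f g : A → ℤ) xs → sumℤ (map (λ x → f x - g x) xs) ≡ sumℤ (map f xs) - sumℤ (map g xs)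
sumℤ-map-- f g []       = refl
sumℤ-map-- f g (x List.∷ xs) = trans (cong (_+_ (f x - g x)) (sumℤ-map-- f g xs)) (interchange (f x) (g x) _ _)
  where
  interchange : ∀ u v U V → (u - v) + (U - V) ≡ (u + U) - (v + V)
  interchange = solve-∀

∑< : ℕ → (ℕ → ℤ) → ℤ
∑< B h = sumℤ (map h (upTo B))

syntax ∑< B (λ j → h) = ∑[ j < B ] h

∑<-suc : ∀ B h → ∑[ j < suc B ] h j ≡ h 0 + ∑[ j < B ] h (suc j)
∑<-suc B h = cong (λ js → h 0 + sumℤ js)
  (trans (List.map-applyUpTo suc h B) (sym (List.map-applyUpTo (λ j → j) (h ∘ suc) B)))

∑<-cong : ∀ B {g h : ℕ → ℤ} → g ≗ h → ∑[ j < B ] g j ≡ ∑[ j < B ] h j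
∑<-cong B g≗h = sumℤ-map-cong g≗h (upTo B)

∑<-zero : ∀ B {h : ℕ → ℤ} → (∀ j → j < B → h j ≡ + 0) → ∑[ j < B ] h j ≡ + 0
∑<-zero zero    h≡0 = refl
∑<-zero (suc B) {h} h≡0 = begin
  ∑[ j < suc B ] h j          ≡⟨ ∑<-suc B h ⟩
  h 0 + ∑[ j < B ] h (suc j)  ≡⟨ cong₂ _+_ (h≡0 0 (s≤s z≤n)) (∑<-zero B {h ∘ suc} (λ j j<B → h≡0 (suc j) (s≤s j<B))) ⟩
  + 0                         ∎

∑<-single : ∀ B {h : ℕ → ℤ} j₀ → j₀ < B → (∀ j → j < B → j ≢ j₀ → h j ≡ + 0) → ∑[ j < B ] h j ≡ h j₀
∑<-single (suc B) {h} zero _ h≡0 = begin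
  ∑[ j < suc B ] h j          ≡⟨ ∑<-suc B h ⟩
  h 0 + ∑[ j < B ] h (suc j)  ≡⟨ cong (_+_ (h 0)) (∑<-zero B {h ∘ suc} (λ j j<B → h≡0 (suc j) (s≤s j<B) (λ ()))) ⟩
  h 0 + + 0                   ≡⟨ ℤ.+-identityʳ (h 0) ⟩
  h 0                         ∎
∑<-single (suc B) {h} (suc j₀) (s≤s j₀<B) h≡0 = begin
  ∑[ j < suc B ] h j          ≡⟨ ∑<-suc B h ⟩
  h 0 + ∑[ j < B ] h (suc j)  ≡⟨ cong₂ _+_ (h≡0 0 (s≤s z≤n) (λ ())) tail ⟩
  + 0 + h (suc j₀)            ≡⟨ ℤ.+-identityˡ (h (suc j₀)) ⟩
  h (suc j₀)                  ∎
  where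
  tail : ∑[ j < B ] h (suc j) ≡ h (suc j₀)
  tail = ∑<-single B {h ∘ suc} j₀ j₀<B (λ j j<B j≢j₀ → h≡0 (suc j) (s≤s j<B) (j≢j₀ ∘ ℕ.suc-injective))

∑<-vanishing-tail : ∀ {B B′} {h : ℕ → ℤ} → B ≤ B′ → (∀ j → B ≤ j → h j ≡ + 0) → ∑[ j < B′ ] h j ≡ ∑[ j < B ] h j
∑<-vanishing-tail {B′ = B′} z≤n h≡0 = ∑<-zero B′ (λ j _ → h≡0 j z≤n)
∑<-vanishing-tail {suc B} {suc B′} {h} (s≤s B≤B′) h≡0 = begin
  ∑[ j < suc B′ ] h j              ≡⟨ ∑<-suc B′ h ⟩
  h 0 + ∑[ j < B′ ] h (suc j)      ≡⟨ cong (_+_ (h 0)) (∑<-vanishing-tail {h = h ∘ suc} B≤B′ (λ j B≤j → h≡0 (suc j) (s≤s B≤j))) ⟩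
  h 0 + ∑[ j < B ] h (suc j)       ≡⟨ ∑<-suc B h ⟨
  ∑[ j < suc B ] h j               ∎

∑<-telescope : ∀ B (g : ℕ → ℤ) → ∑[ j < B ] (g j - g (suc j)) ≡ g 0 - g B
∑<-telescope zero    g = sym (ℤ.+-inverseʳ (g 0))
∑<-telescope (suc B) g = begin
  ∑[ j < suc B ] (g j - g (suc j))                   ≡⟨ ∑<-suc B (λ j → g j - g (suc j)) ⟩
  (g 0 - g 1) + ∑[ j < B ] (g (suc j) - g (suc (suc j))) ≡⟨ cong (_+_ (g 0 - g 1)) (∑<-telescope B (g ∘ suc)) ⟩
  (g 0 - g 1) + (g 1 - g (suc B))                    ≡⟨ ℤ.+-minus-telescope (g 0) (g 1) (g (suc B)) ⟩
  g 0 - g (suc B)                                    ∎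

-- The operators 1 - x^a and 1/(1 - x^a)

∇ : ℕ → (ℤ → ℤ) → ℤ → ℤ
∇ a f x = f x - f (x - + a)

∇-cong : ∀ a {f g : ℤ → ℤ} → f ≗ g → ∇ a f ≗ ∇ a g
∇-cong a f≗g x = cong₂ _-_ (f≗g x) (f≗g (x - + a))

∇-comm : ∀ a b f → ∇ a (∇ b f) ≗ ∇ b (∇ a f)
∇-comm a b f x = begin
  (f x - f (x - + b)) - (f (x - + a) - f (x - + a - + b))
    ≡⟨ cong (λ y → (f x - f (x - + b)) - (f (x - + a) - f y)) (swap x (+ a) (+ b)) ⟩
  (f x - f (x - + b)) - (f (x - + a) - f (x - + b - + a))
    ≡⟨ exchange (f x) (f (x - + b)) (f (x - + a)) (f (x - + b - + a)) ⟩
  (f x - f (x - + a)) - (f (x - + b) - f (x - + b - + a)) ∎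
  where
  swap : ∀ x u v → x - u - v ≡ x - v - u
  swap = solve-∀
  exchange : ∀ u v w z → (u - v) - (w - z) ≡ (u - w) - (v - z)
  exchange = solve-∀

coeffℤ : Series → ℤ → ℤ
coeffℤ c (+ k)    = c k
coeffℤ c -[1+ _ ] = + 0

coeffℤ-cong : ∀ {c d : Series} → c ≗ d → coeffℤ c ≗ coeffℤ d
coeffℤ-cong c≗d (+ k)    = c≗d k
coeffℤ-cong c≗d -[1+ _ ] = refl

if-≤ᵇ-yes : ∀ {A : Set} {m n} {x y : A} → m ≤ n → (if m ≤ᵇ n then x else y) ≡ x
if-≤ᵇ-yes {m = m} {n} {x} {y} m≤n = cong (if_then x else y) (dec-true (m ℕ.≤? n) m≤n)

if-≤ᵇ-no : ∀ {A : Set} {m n} {x y : A} → n < m → (if m ≤ᵇ n then x else y) ≡ y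
if-≤ᵇ-no {m = m} {n} {x} {y} n<m = cong (if_then x else y) (dec-false (m ℕ.≤? n) (ℕ.<⇒≱ n<m))

lag : ℕ → Series → Series
lag a c k = if a ≤ᵇ k then c (k ℕ.∸ a) else + 0

coeffℤ-lag : ∀ a c k → lag a c k ≡ coeffℤ c (+ k - + a)
coeffℤ-lag a c k with ℕ.≤-<-connex a k
... | inj₁ a≤k = begin
  lag a c k                ≡⟨ if-≤ᵇ-yes a≤k ⟩
  coeffℤ c (+ (k ℕ.∸ a))   ≡⟨ cong (coeffℤ c) (ℤ.⊖-≥ a≤k) ⟨
  coeffℤ c (k ⊖ a)         ≡⟨ cong (coeffℤ c) (ℤ.[+m]-[+n]≡m⊖n k a) ⟨
  coeffℤ c (+ k - + a)     ∎
... | inj₂ k<a = begin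
  lag a c k                ≡⟨ if-≤ᵇ-no k<a ⟩
  + 0                      ≡⟨ negative (a ℕ.∸ k) (ℕ.m<n⇒0<n∸m k<a) ⟨
  coeffℤ c (- + (a ℕ.∸ k)) ≡⟨ cong (coeffℤ c) (trans (ℤ.[+m]-[+n]≡m⊖n k a) (ℤ.⊖-< k<a)) ⟨
  coeffℤ c (+ k - + a)     ∎
  where
  negative : ∀ n → 0 < n → coeffℤ c (- + n) ≡ + 0
  negative (suc n) _ = refl

coeffℤ-mulOneMinus : ∀ a c → coeffℤ (mulOneMinus a c) ≗ ∇ a (coeffℤ c)
coeffℤ-mulOneMinus a c (+ k) = cong (_-_ (c k)) (coeffℤ-lag a c k)
coeffℤ-mulOneMinus zero    c -[1+ _ ] = refl
coeffℤ-mulOneMinus (suc a) c -[1+ _ ] = refl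

mulOneMinus-cong : ∀ a {c d} → c ≗ d → mulOneMinus a c ≗ mulOneMinus a d
mulOneMinus-cong a {c} {d} c≗d k = begin
  mulOneMinus a c k      ≡⟨ coeffℤ-mulOneMinus a c (+ k) ⟩
  ∇ a (coeffℤ c) (+ k)   ≡⟨ ∇-cong a (coeffℤ-cong c≗d) (+ k) ⟩
  ∇ a (coeffℤ d) (+ k)   ≡⟨ coeffℤ-mulOneMinus a d (+ k) ⟨
  mulOneMinus a d k      ∎

mulOneMinus-comm : ∀ a b c → mulOneMinus a (mulOneMinus b c) ≗ mulOneMinus b (mulOneMinus a c)
mulOneMinus-comm a b c k = begin
  mulOneMinus a (mulOneMinus b c) k    ≡⟨ coeffℤ-mulOneMinus a (mulOneMinus b c) (+ k) ⟩
  ∇ a (coeffℤ (mulOneMinus b c)) (+ k) ≡⟨ ∇-cong a (coeffℤ-mulOneMinus b c) (+ k) ⟩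
  ∇ a (∇ b (coeffℤ c)) (+ k)           ≡⟨ ∇-comm a b (coeffℤ c) (+ k) ⟩
  ∇ b (∇ a (coeffℤ c)) (+ k)           ≡⟨ ∇-cong b (coeffℤ-mulOneMinus a c) (+ k) ⟨
  ∇ b (coeffℤ (mulOneMinus a c)) (+ k) ≡⟨ coeffℤ-mulOneMinus b (mulOneMinus a c) (+ k) ⟨
  mulOneMinus b (mulOneMinus a c) k    ∎

module _ (a : ℕ) .{{_ : NonZero a}} where

  k∸a<k : ∀ {k} → a ≤ k → k ℕ.∸ a < k
  k∸a<k a≤k = ℕ.∸-monoʳ-< (ℕ.>-nonZero⁻¹ a) a≤k

  mulOneMinus-injective : ∀ {c d} → mulOneMinus a c ≗ mulOneMinus a d → c ≗ d
  mulOneMinus-injective {c} {d} e = <-rec (λ k → c k ≡ d k) step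
    where
    step : ∀ k → (∀ {j} → j < k → c j ≡ d j) → c k ≡ d k
    step k ih = begin
      c k                                ≡⟨ m-n+n≡m (c k) (lag a c k) ⟨
      mulOneMinus a c k + lag a c k      ≡⟨ cong₂ _+_ (e k) lag-≡ ⟩
      mulOneMinus a d k + lag a d k      ≡⟨ m-n+n≡m (d k) (lag a d k) ⟩
      d k                                ∎
      where
      lag-≡ : lag a c k ≡ lag a d k
      lag-≡ with ℕ.≤-<-connex a k
      ... | inj₁ a≤k = trans (if-≤ᵇ-yes a≤k) (trans (ih (k∸a<k a≤k)) (sym (if-≤ᵇ-yes a≤k)))
      ... | inj₂ k<a = trans (if-≤ᵇ-no k<a) (sym (if-≤ᵇ-no k<a))

  geometricTerm : Series → ℕ → ℕ → ℤ
  geometricTerm c k j = if j ℕ.* a ≤ᵇ k then c (k ℕ.∸ j ℕ.* a) else + 0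

  geometricTerm-vanishes : ∀ c {k} j → k < j → geometricTerm c k j ≡ + 0
  geometricTerm-vanishes c j k<j = if-≤ᵇ-no (ℕ.<-≤-trans k<j (ℕ.m≤m*n j a))

  geometricTerm-suc : ∀ c {k} j → a ≤ k → geometricTerm c k (suc j) ≡ geometricTerm c (k ℕ.∸ a) j
  geometricTerm-suc c {k} j a≤k with j ℕ.* a ℕ.≤? k ℕ.∸ a
  ... | yes ja≤k-a = begin
    geometricTerm c k (suc j)          ≡⟨ if-≤ᵇ-yes (subst (ℕ._≤ k) (ℕ.+-comm (j ℕ.* a) a) (ℕ.m≤o∸n⇒m+n≤o (j ℕ.* a) a≤k ja≤k-a)) ⟩
    c (k ℕ.∸ (a ℕ.+ j ℕ.* a))          ≡⟨ cong c (ℕ.∸-+-assoc k a (j ℕ.* a)) ⟨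
    c (k ℕ.∸ a ℕ.∸ j ℕ.* a)            ≡⟨ if-≤ᵇ-yes ja≤k-a ⟨
    geometricTerm c (k ℕ.∸ a) j        ∎
  ... | no ja≰k-a = trans (if-≤ᵇ-no (ℕ.≰⇒> (ja≰k-a ∘ back))) (sym (if-≤ᵇ-no (ℕ.≰⇒> ja≰k-a)))
    where
    back : a ℕ.+ j ℕ.* a ≤ k → j ℕ.* a ≤ k ℕ.∸ a
    back h = ℕ.m+n≤o⇒m≤o∸n (j ℕ.* a) (subst (ℕ._≤ k) (ℕ.+-comm a (j ℕ.* a)) h)

  divOneMinus-unfold : ∀ c k → divOneMinus a c k ≡ c k + lag a (divOneMinus a c) k
  divOneMinus-unfold c k with ℕ.≤-<-connex a k
  ... | inj₁ a≤k = begin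
    ∑[ j < suc k ] geometricTerm c k j                      ≡⟨ ∑<-suc k (geometricTerm c k) ⟩
    c k + ∑[ j < k ] geometricTerm c k (suc j)              ≡⟨ cong (_+_ (c k)) (∑<-cong k (λ j → geometricTerm-suc c j a≤k)) ⟩
    c k + ∑[ j < k ] geometricTerm c (k ℕ.∸ a) j            ≡⟨ cong (_+_ (c k)) (∑<-vanishing-tail (k∸a<k a≤k) tail) ⟩
    c k + ∑[ j < suc (k ℕ.∸ a) ] geometricTerm c (k ℕ.∸ a) j ≡⟨ cong (_+_ (c k)) (if-≤ᵇ-yes a≤k) ⟨
    c k + lag a (divOneMinus a c) k                          ∎
    where
    tail : ∀ j → suc (k ℕ.∸ a) ≤ j → geometricTerm c (k ℕ.∸ a) j ≡ + 0
    tail j = geometricTerm-vanishes c j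
  ... | inj₂ k<a = begin
    ∑[ j < suc k ] geometricTerm c k j                      ≡⟨ ∑<-suc k (geometricTerm c k) ⟩
    c k + ∑[ j < k ] geometricTerm c k (suc j)              ≡⟨ cong (_+_ (c k)) (∑<-zero k (λ j _ → beyond j)) ⟩
    c k + + 0                                                ≡⟨ cong (_+_ (c k)) (if-≤ᵇ-no k<a) ⟨
    c k + lag a (divOneMinus a c) k                          ∎
    where
    beyond : ∀ j → geometricTerm c k (suc j) ≡ + 0
    beyond j = if-≤ᵇ-no (ℕ.<-≤-trans k<a (ℕ.m≤m+n a (j ℕ.* a)))

  mulOneMinus-divOneMinus : ∀ c → mulOneMinus a (divOneMinus a c) ≗ c
  mulOneMinus-divOneMinus c k = begin
    divOneMinus a c k - lag a (divOneMinus a c) k                    ≡⟨ cong (_- lag a (divOneMinus a c) k) (divOneMinus-unfold c k) ⟩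
    c k + lag a (divOneMinus a c) k - lag a (divOneMinus a c) k      ≡⟨ m+n-n≡m (c k) _ ⟩
    c k                                                              ∎

  divOneMinus-cong : ∀ {c d} → c ≗ d → divOneMinus a c ≗ divOneMinus a d
  divOneMinus-cong {c} {d} c≗d = mulOneMinus-injective λ k →
    trans (mulOneMinus-divOneMinus c k) (trans (c≗d k) (sym (mulOneMinus-divOneMinus d k)))

  divOneMinus-mulOneMinus-comm : ∀ b c → divOneMinus a (mulOneMinus b c) ≗ mulOneMinus b (divOneMinus a c)
  divOneMinus-mulOneMinus-comm b c = mulOneMinus-injective λ k → begin
    mulOneMinus a (divOneMinus a (mulOneMinus b c)) k  ≡⟨ mulOneMinus-divOneMinus (mulOneMinus b c) k ⟩
    mulOneMinus b c k                                  ≡⟨ mulOneMinus-cong b (mulOneMinus-divOneMinus c) k ⟨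
    mulOneMinus b (mulOneMinus a (divOneMinus a c)) k  ≡⟨ mulOneMinus-comm b a (divOneMinus a c) k ⟩
    mulOneMinus a (mulOneMinus b (divOneMinus a c)) k  ∎

multiple-below-zero : ∀ {p r} → r < p → p ∣ r → r ≡ 0
multiple-below-zero {r = zero}  _   _   = refl
multiple-below-zero {r = suc r} r<p p∣r = contradiction p∣r (>⇒∤ r<p)

∣-minus-comm : ∀ {d a b} → d ∣ℤ a - b → d ∣ℤ b - a
∣-minus-comm {d} {a} {b} d∣a-b = subst (d ∣ℤ_) (negate a b) (ℤ∣.∣m⇒∣-m d∣a-b)
  where
  negate : ∀ a b → - (a - b) ≡ b - a
  negate = solve-∀

module _ (p : ℕ) .{{_ : NonZero p}} where

  private
    division : ∀ x → x ≡ + (x %ℕ p) + (x /ℕ p) * + p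
    division x = a≡a%ℕn+[a/ℕn]*n x p

  ∣⇒%ℕ≡0 : ∀ {x} → + p ∣ℤ x → x %ℕ p ≡ 0
  ∣⇒%ℕ≡0 {x} (divides t x≡tp) = multiple-below-zero (n%ℕd<d x p) (ℤ∣.∣⇒∣ᵤ (divides (t - x /ℕ p) (begin
    + (x %ℕ p)                             ≡⟨ m+n-n≡m (+ (x %ℕ p)) ((x /ℕ p) * + p) ⟨
    + (x %ℕ p) + (x /ℕ p) * + p - (x /ℕ p) * + p ≡⟨ cong (_- (x /ℕ p) * + p) (division x) ⟨
    x - (x /ℕ p) * + p                     ≡⟨ cong (_- (x /ℕ p) * + p) x≡tp ⟩
    t * + p - (x /ℕ p) * + p               ≡⟨ distrib t (x /ℕ p) (+ p) ⟩
    (t - x /ℕ p) * + p                     ∎)))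
    where
    distrib : ∀ t s u → t * u - s * u ≡ (t - s) * u
    distrib = solve-∀

  %ℕ≡0⇒∣ : ∀ {x} → x %ℕ p ≡ 0 → + p ∣ℤ x
  %ℕ≡0⇒∣ {x} x%p≡0 = divides (x /ℕ p) (begin
    x                              ≡⟨ division x ⟩
    + (x %ℕ p) + (x /ℕ p) * + p    ≡⟨ cong (λ r → + r + (x /ℕ p) * + p) x%p≡0 ⟩
    + 0 + (x /ℕ p) * + p           ≡⟨ ℤ.+-identityˡ _ ⟩
    (x /ℕ p) * + p                 ∎)

  [t*p]/ℕp≡t : ∀ t → (t * + p) /ℕ p ≡ t
  [t*p]/ℕp≡t t = sym (ℤ.*-cancelʳ-≡ t ((t * + p) /ℕ p) (+ p) (begin
    t * + p                                        ≡⟨ division (t * + p) ⟩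
    + ((t * + p) %ℕ p) + ((t * + p) /ℕ p) * + p     ≡⟨ cong (λ r → + r + ((t * + p) /ℕ p) * + p) (∣⇒%ℕ≡0 (divides t refl)) ⟩
    + 0 + ((t * + p) /ℕ p) * + p                   ≡⟨ ℤ.+-identityˡ _ ⟩
    ((t * + p) /ℕ p) * + p                         ∎))

divides?-sound : ∀ x p .{{_ : NonZero p}} → divides? x p ≡ true → + p ∣ℤ x
divides?-sound x (suc d) holds = %ℕ≡0⇒∣ (suc d) (ℕ.≡ᵇ⇒≡ _ 0 (subst T (sym holds) _))

divides?-complete : ∀ x p .{{_ : NonZero p}} → + p ∣ℤ x → divides? x p ≡ true
divides?-complete x (suc d) p∣x = cong (ℕ._≡ᵇ 0) (∣⇒%ℕ≡0 (suc d) p∣x)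

divExact-multiple : ∀ t p .{{_ : NonZero p}} → divExact (t * + p) p ≡ t
divExact-multiple t (suc d) = [t*p]/ℕp≡t (suc d) t

-- Substituting x^p

stretch : (p : ℕ) .{{_ : NonZero p}} → Series → Series
stretch p c k = if k ℕ.% p ℕ.≡ᵇ 0 then c (k ℕ./ p) else + 0

coeffℤ-stretch-multiple : ∀ p .{{_ : NonZero p}} c t → coeffℤ (stretch p c) (t * + p) ≡ coeffℤ c t
coeffℤ-stretch-multiple p c (+ n) = begin
  coeffℤ (stretch p c) (+ n * + p)                                     ≡⟨ cong (coeffℤ (stretch p c)) (ℤ.pos-* n p) ⟨
  (if n ℕ.* p ℕ.% p ℕ.≡ᵇ 0 then c (n ℕ.* p ℕ./ p) else + 0)           ≡⟨ cong (λ r → if r ℕ.≡ᵇ 0 then c (n ℕ.* p ℕ./ p) else + 0) (ℕ.m*n%n≡0 n p) ⟩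
  c (n ℕ.* p ℕ./ p)                                                    ≡⟨ cong c (ℕ.m*n/n≡m n p) ⟩
  c n                                                                  ∎
coeffℤ-stretch-multiple (suc _) c -[1+ n ] = refl

coeffℤ-stretch-nonmultiple : ∀ p .{{_ : NonZero p}} c {x} → ¬ (+ p ∣ℤ x) → coeffℤ (stretch p c) x ≡ + 0
coeffℤ-stretch-nonmultiple p c {+ k} p∤k = cong (if_then c (k ℕ./ p) else + 0) (dec-false (k ℕ.% p ℕ.≟ 0) (p∤k ∘ %ℕ≡0⇒∣ p {+ k}))
coeffℤ-stretch-nonmultiple p c {x = -[1+ _ ]} _ = refl

stretch-mulOneMinus : ∀ p .{{_ : NonZero p}} a c → mulOneMinus (p ℕ.* a) (stretch p c) ≗ stretch p (mulOneMinus a c)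
stretch-mulOneMinus p a c k = trans (coeffℤ-mulOneMinus (p ℕ.* a) (stretch p c) (+ k)) (onℤ (+ k))
  where
  onℤ : ∇ (p ℕ.* a) (coeffℤ (stretch p c)) ≗ coeffℤ (stretch p (mulOneMinus a c))
  onℤ x with + p ∣? x
  ... | yes (divides t refl) = begin
    coeffℤ (stretch p c) (t * + p) - coeffℤ (stretch p c) (t * + p - + (p ℕ.* a))
      ≡⟨ cong (λ y → coeffℤ (stretch p c) (t * + p) - coeffℤ (stretch p c) y) shift ⟩
    coeffℤ (stretch p c) (t * + p) - coeffℤ (stretch p c) ((t - + a) * + p)
      ≡⟨ cong₂ _-_ (coeffℤ-stretch-multiple p c t) (coeffℤ-stretch-multiple p c (t - + a)) ⟩
    ∇ a (coeffℤ c) t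
      ≡⟨ coeffℤ-mulOneMinus a c t ⟨
    coeffℤ (mulOneMinus a c) t
      ≡⟨ coeffℤ-stretch-multiple p (mulOneMinus a c) t ⟨
    coeffℤ (stretch p (mulOneMinus a c)) (t * + p) ∎
    where
    distrib : ∀ t u v → t * u - v * u ≡ (t - v) * u
    distrib = solve-∀
    shift : t * + p - + (p ℕ.* a) ≡ (t - + a) * + p
    shift = trans (cong (λ y → t * + p - y) (trans (ℤ.pos-* p a) (ℤ.*-comm (+ p) (+ a)))) (distrib t (+ p) (+ a))
  ... | no p∤x = begin
    coeffℤ (stretch p c) x - coeffℤ (stretch p c) (x - + (p ℕ.* a))
      ≡⟨ cong₂ _-_ (coeffℤ-stretch-nonmultiple p c p∤x) (coeffℤ-stretch-nonmultiple p c (p∤x ∘ restore)) ⟩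
    + 0
      ≡⟨ coeffℤ-stretch-nonmultiple p (mulOneMinus a c) p∤x ⟨
    coeffℤ (stretch p (mulOneMinus a c)) x ∎
    where
    restore : + p ∣ℤ x - + (p ℕ.* a) → + p ∣ℤ x
    restore p∣x-pa = subst (+ p ∣ℤ_) (m-n+n≡m x _)
      (ℤ∣.∣m∣n⇒∣m+n p∣x-pa (divides (+ a) (trans (ℤ.pos-* p a) (ℤ.*-comm (+ p) (+ a)))))

stretch-cong : ∀ p .{{_ : NonZero p}} {c d} → c ≗ d → stretch p c ≗ stretch p d
stretch-cong p c≗d k = cong (if k ℕ.% p ℕ.≡ᵇ 0 then_else + 0) (c≗d (k ℕ./ p))

stretch-divOneMinus : ∀ p .{{_ : NonZero p}} a .{{_ : NonZero a}} c →
                      divOneMinus (p ℕ.* a) (stretch p c) ≗ stretch p (divOneMinus a c)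
stretch-divOneMinus p a c = mulOneMinus-injective (p ℕ.* a) {{ℕ.m*n≢0 p a}} λ k → begin
  mulOneMinus (p ℕ.* a) (divOneMinus (p ℕ.* a) (stretch p c)) k ≡⟨ mulOneMinus-divOneMinus (p ℕ.* a) {{ℕ.m*n≢0 p a}} (stretch p c) k ⟩
  stretch p c k                                                  ≡⟨ stretch-cong p (mulOneMinus-divOneMinus a c) k ⟨
  stretch p (mulOneMinus a (divOneMinus a c)) k                  ≡⟨ stretch-mulOneMinus p a (divOneMinus a c) k ⟨
  mulOneMinus (p ℕ.* a) (stretch p (divOneMinus a c)) k          ∎

stretch-oneS : ∀ p .{{_ : NonZero p}} → stretch p oneS ≗ oneS
stretch-oneS (suc _) zero    = refl
stretch-oneS p       (suc k) with + p ∣? + suc k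
... | no p∤k              = coeffℤ-stretch-nonmultiple p oneS p∤k
... | yes (divides t k≡tp) = begin
  coeffℤ (stretch p oneS) (+ suc k)  ≡⟨ cong (coeffℤ (stretch p oneS)) k≡tp ⟩
  coeffℤ (stretch p oneS) (t * + p)  ≡⟨ coeffℤ-stretch-multiple p oneS t ⟩
  coeffℤ oneS t                      ≡⟨ nonzero t k≡tp ⟩
  + 0                                ∎
  where
  nonzero : ∀ t → + suc k ≡ t * + p → coeffℤ oneS t ≡ + 0
  nonzero (+ zero)  ()
  nonzero (+ suc _) _ = refl
  nonzero -[1+ _ ] _ = refl

module _ {A B C : Set} where

  Preserves-≗ : (A → (B → C) → (B → C)) → Set
  Preserves-≗ f = ∀ x {g h} → g ≗ h → f x g ≗ f x h

  foldr-cong-≗ : ∀ {f} → Preserves-≗ f → ∀ {z z′} → z ≗ z′ → ∀ xs → foldr f z xs ≗ foldr f z′ xs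
  foldr-cong-≗ f-cong z≗z′ []       = z≗z′
  foldr-cong-≗ f-cong z≗z′ (x List.∷ xs) = f-cong x (foldr-cong-≗ f-cong z≗z′ xs)

foldr-interchange-≗ : ∀ {A A′ B C : Set} {f : A → (B → C) → (B → C)} {g : A′ → (B → C) → (B → C)} →
                      Preserves-≗ f → Preserves-≗ g → (∀ x y c → f x (g y c) ≗ g y (f x c)) →
                      ∀ xs ys z → foldr f (foldr g z ys) xs ≗ foldr g (foldr f z xs) ys
foldr-interchange-≗ {f = f} {g} f-cong g-cong comm xs ys z = interchange xs
  where
  pass : ∀ x ys c → f x (foldr g c ys) ≗ foldr g (f x c) ys
  pass x []       c k = refl
  pass x (y List.∷ ys) c k = trans (comm x y (foldr g c ys) k) (g-cong y (pass x ys c) k)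
  interchange : ∀ xs → foldr f (foldr g z ys) xs ≗ foldr g (foldr f z xs) ys
  interchange []       k = refl
  interchange (x List.∷ xs) k = trans (f-cong x (interchange xs) k) (pass x ys (foldr f z xs) k)

foldr-fusion-≗ : ∀ {A B C B′ C′ : Set} {f : A → (B → C) → (B → C)} {g : A → (B′ → C′) → (B′ → C′)}
                 (Φ : (B → C) → (B′ → C′)) → Preserves-≗ g → (∀ x c → Φ (f x c) ≗ g x (Φ c)) →
                 ∀ xs z → Φ (foldr f z xs) ≗ foldr g (Φ z) xs
foldr-fusion-≗ Φ g-cong fuse []       z k = refl
foldr-fusion-≗ {f = f} Φ g-cong fuse (x List.∷ xs) z k = trans (fuse x (foldr f z xs) k) (g-cong x (foldr-fusion-≗ Φ g-cong fuse xs z) k)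

∏mulOneMinus : ∀ {A : Set} → (A → ℕ) → List A → Series → Series
∏mulOneMinus w xs c = foldr (λ x → mulOneMinus (w x)) c xs

∏divOneMinus : ∀ {A : Set} → (A → ℕ) → List A → Series → Series
∏divOneMinus w xs c = foldr (λ x → divOneMinus (w x)) c xs

∏∇ : ∀ {A : Set} → (A → ℕ) → List A → (ℤ → ℤ) → ℤ → ℤ
∏∇ w xs f = foldr (λ x → ∇ (w x)) f xs

module _ {A : Set} (w : A → ℕ) where

  ∏mulOneMinus-cong : ∀ xs {c d} → c ≗ d → ∏mulOneMinus w xs c ≗ ∏mulOneMinus w xs d
  ∏mulOneMinus-cong xs c≗d = foldr-cong-≗ (λ x → mulOneMinus-cong (w x)) c≗d xs

  stretch-∏mulOneMinus : ∀ p .{{_ : NonZero p}} xs c →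
                         stretch p (∏mulOneMinus w xs c) ≗ ∏mulOneMinus (λ x → p ℕ.* w x) xs (stretch p c)
  stretch-∏mulOneMinus p xs c = foldr-fusion-≗ (stretch p) (λ x → mulOneMinus-cong (p ℕ.* w x))
    (λ x c k → sym (stretch-mulOneMinus p (w x) c k)) xs c

  module _ (w-nonZero : ∀ x → NonZero (w x)) where

    ∏divOneMinus-cong : ∀ xs {c d} → c ≗ d → ∏divOneMinus w xs c ≗ ∏divOneMinus w xs d
    ∏divOneMinus-cong xs c≗d = foldr-cong-≗ (λ x → divOneMinus-cong (w x) {{w-nonZero x}}) c≗d xs

    ∏divOneMinus-∏mulOneMinus-comm : ∀ {B : Set} (v : B → ℕ) xs ys c →
      ∏divOneMinus w xs (∏mulOneMinus v ys c) ≗ ∏mulOneMinus v ys (∏divOneMinus w xs c)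
    ∏divOneMinus-∏mulOneMinus-comm v xs ys c = foldr-interchange-≗
      (λ x → divOneMinus-cong (w x) {{w-nonZero x}}) (λ y → mulOneMinus-cong (v y))
      (λ x y → divOneMinus-mulOneMinus-comm (w x) {{w-nonZero x}} (v y)) xs ys c

    stretch-∏divOneMinus : ∀ p .{{_ : NonZero p}} xs c →
                           stretch p (∏divOneMinus w xs c) ≗ ∏divOneMinus (λ x → p ℕ.* w x) xs (stretch p c)
    stretch-∏divOneMinus p xs c = foldr-fusion-≗ (stretch p)
      (λ x → divOneMinus-cong (p ℕ.* w x) {{ℕ.m*n≢0 p (w x) {{it}} {{w-nonZero x}}}})
      (λ x c k → sym (stretch-divOneMinus p (w x) {{w-nonZero x}} c k)) xs c

module _ {A : Set} (w : A → ℕ) (xs : List A) where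

  ∏∇-cong : ∀ {f g} → f ≗ g → ∏∇ w xs f ≗ ∏∇ w xs g
  ∏∇-cong f≗g = foldr-cong-≗ (λ x → ∇-cong (w x)) f≗g xs

  coeffℤ-∏mulOneMinus : ∀ c → coeffℤ (∏mulOneMinus w xs c) ≗ ∏∇ w xs (coeffℤ c)
  coeffℤ-∏mulOneMinus c = foldr-fusion-≗ coeffℤ (λ x → ∇-cong (w x)) (λ x → coeffℤ-mulOneMinus (w x)) xs c

-- The factorisation of P_{pN}

without : ∀ {m} → Fin m → List (Fin m) → List (Fin m)
without i = filter (λ k → ¬? (k ≟ i))

without-zero-map-suc : ∀ {m} (xs : List (Fin m)) → without zero (map suc xs) ≡ map suc xs
without-zero-map-suc []       = refl
without-zero-map-suc (x List.∷ xs) = cong (suc x List.∷_) (without-zero-map-suc xs)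

without-suc-map-suc : ∀ {m} (i : Fin m) xs → without (suc i) (map suc xs) ≡ map suc (without i xs)
without-suc-map-suc i []       = refl
without-suc-map-suc i (x List.∷ xs) with does (x ≟ i)
... | true  = without-suc-map-suc i xs
... | false = cong (suc x List.∷_) (without-suc-map-suc i xs)

allFin-suc : ∀ m → allFin (suc m) ≡ zero List.∷ map suc (allFin m)
allFin-suc m = cong (zero List.∷_) (sym (List.map-tabulate (λ i → i) suc))

concatMap-map-map : ∀ {A B C : Set} (f : B → C) (g : A → List B) xs → concatMap (map f ∘ g) xs ≡ map f (concatMap g xs)
concatMap-map-map f g xs = trans (cong concat (List.map-∘ xs)) (List.concat-map (map g xs))

concatMap-singleton : ∀ {A B : Set} (f : A → B) xs → concatMap (List.[_] ∘ f) xs ≡ map f xs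
concatMap-singleton f xs = trans (cong concat (List.map-∘ xs)) (List.concat-map-[ map f xs ])

pairsLt-suc : ∀ m → pairsLt (suc m) ≡ map (λ j → (zero , suc j)) (allFin m) ++ map (Product.map suc suc) (pairsLt m)
pairsLt-suc m = begin
  concatMap row (allFin (suc m))                              ≡⟨ cong (concatMap row) (allFin-suc m) ⟩
  row zero ++ concatMap row (map suc (allFin m))              ≡⟨ cong (row zero ++_) (List.concatMap-map row suc (allFin m)) ⟩
  row zero ++ concatMap (row ∘ suc) (allFin m)                ≡⟨ cong₂ _++_ firstRow laterRows ⟩
  map (λ j → (zero , suc j)) (allFin m) ++ map (Product.map suc suc) (pairsLt m) ∎
  where
  pairIfLt : ∀ {n} → Fin n → Fin n → List (Fin n × Fin n)
  pairIfLt i j = if toℕ i ℕ.<ᵇ toℕ j then List.[ (i , j) ] else []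
  row : Fin (suc m) → List (Fin (suc m) × Fin (suc m))
  row i = concatMap (pairIfLt i) (allFin (suc m))
  row-unfold : ∀ i → row i ≡ pairIfLt i zero ++ concatMap (pairIfLt i ∘ suc) (allFin m)
  row-unfold i = trans (cong (concatMap (pairIfLt i)) (allFin-suc m)) (cong (pairIfLt i zero ++_) (List.concatMap-map (pairIfLt i) suc (allFin m)))
  pairIfLt-suc : ∀ i j → pairIfLt (suc i) (suc j) ≡ map (Product.map suc suc) (pairIfLt i j)
  pairIfLt-suc i j with toℕ i ℕ.<ᵇ toℕ j
  ... | true  = refl
  ... | false = refl
  firstRow : row zero ≡ map (λ j → (zero , suc j)) (allFin m)
  firstRow = trans (row-unfold zero) (concatMap-singleton (λ j → (zero , suc j)) (allFin m))
  laterRow : ∀ i → row (suc i) ≡ map (Product.map suc suc) (concatMap (pairIfLt i) (allFin m))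
  laterRow i = trans (row-unfold (suc i)) (trans (List.concatMap-cong (pairIfLt-suc i) (allFin m)) (concatMap-map-map _ (pairIfLt i) (allFin m)))
  laterRows : concatMap (row ∘ suc) (allFin m) ≡ map (Product.map suc suc) (pairsLt m)
  laterRows = trans (List.concatMap-cong laterRow (allFin m)) (concatMap-map-map _ (λ i → concatMap (pairIfLt i) (allFin m)) (allFin m))

numeratorP : ∀ {m} → (Fin m → ℕ) → Series
numeratorP {m} q = ∏mulOneMinus (λ ij → bigMij q (proj₁ ij) (proj₂ ij)) (pairsLt m) (mulOneMinus (bigM q) oneS)

scaledNumeratorP : ∀ {m} → ℕ → (Fin m → ℕ) → Series
scaledNumeratorP {m} p q =
  ∏mulOneMinus (λ ij → p ℕ.* bigMij q (proj₁ ij) (proj₂ ij)) (pairsLt m) (mulOneMinus (p ℕ.* bigM q) oneS)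

module _ {m} (p : ℕ) (ps : Fin m → ℕ) where

  private
    prodℕ-map-suc : ∀ xs → prodℕ (map (p ∷ ps) (map suc xs)) ≡ prodℕ (map ps xs)
    prodℕ-map-suc xs = cong prodℕ (sym (List.map-∘ xs))

    prodℕ-over : (List (Fin (suc m)) → List (Fin (suc m))) → List (Fin (suc m)) → ℕ
    prodℕ-over select xs = prodℕ (map (p ∷ ps) (select xs))

  bigM-∷ : bigM (p ∷ ps) ≡ p ℕ.* bigM ps
  bigM-∷ = trans (cong (prodℕ-over (λ xs → xs)) (allFin-suc m)) (cong (p ℕ.*_) (prodℕ-map-suc (allFin m)))

  bigMi-∷-zero : bigMi (p ∷ ps) zero ≡ bigM ps
  bigMi-∷-zero = begin
    prodℕ-over (without zero) (allFin (suc m))                 ≡⟨ cong (prodℕ-over (without zero)) (allFin-suc m) ⟩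
    prodℕ (map (p ∷ ps) (without zero (map suc (allFin m))))   ≡⟨ cong (prodℕ ∘ map (p ∷ ps)) (without-zero-map-suc (allFin m)) ⟩
    prodℕ (map (p ∷ ps) (map suc (allFin m)))                  ≡⟨ prodℕ-map-suc (allFin m) ⟩
    bigM ps                                                    ∎

  bigMi-∷-suc : ∀ i → bigMi (p ∷ ps) (suc i) ≡ p ℕ.* bigMi ps i
  bigMi-∷-suc i = begin
    prodℕ-over (without (suc i)) (allFin (suc m))                        ≡⟨ cong (prodℕ-over (without (suc i))) (allFin-suc m) ⟩
    p ℕ.* prodℕ (map (p ∷ ps) (without (suc i) (map suc (allFin m))))    ≡⟨ cong (λ xs → p ℕ.* prodℕ (map (p ∷ ps) xs)) (without-suc-map-suc i (allFin m)) ⟩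
    p ℕ.* prodℕ (map (p ∷ ps) (map suc (without i (allFin m))))          ≡⟨ cong (p ℕ.*_) (prodℕ-map-suc (without i (allFin m))) ⟩
    p ℕ.* bigMi ps i                                                     ∎

  bigMij-∷-zero : ∀ j → bigMij (p ∷ ps) zero (suc j) ≡ bigMi ps j
  bigMij-∷-zero j = begin
    prodℕ-over (without (suc j) ∘ without zero) (allFin (suc m))          ≡⟨ cong (prodℕ-over (without (suc j) ∘ without zero)) (allFin-suc m) ⟩
    prodℕ (map (p ∷ ps) (without (suc j) (without zero (map suc (allFin m)))))
      ≡⟨ cong (prodℕ ∘ map (p ∷ ps) ∘ without (suc j)) (without-zero-map-suc (allFin m)) ⟩
    prodℕ (map (p ∷ ps) (without (suc j) (map suc (allFin m))))          ≡⟨ cong (prodℕ ∘ map (p ∷ ps)) (without-suc-map-suc j (allFin m)) ⟩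
    prodℕ (map (p ∷ ps) (map suc (without j (allFin m))))                ≡⟨ prodℕ-map-suc (without j (allFin m)) ⟩
    bigMi ps j                                                           ∎

  bigMij-∷-suc : ∀ i j → bigMij (p ∷ ps) (suc i) (suc j) ≡ p ℕ.* bigMij ps i j
  bigMij-∷-suc i j = begin
    prodℕ-over (without (suc j) ∘ without (suc i)) (allFin (suc m))
      ≡⟨ cong (prodℕ-over (without (suc j) ∘ without (suc i))) (allFin-suc m) ⟩
    p ℕ.* prodℕ (map (p ∷ ps) (without (suc j) (without (suc i) (map suc (allFin m)))))
      ≡⟨ cong (λ xs → p ℕ.* prodℕ (map (p ∷ ps) (without (suc j) xs))) (without-suc-map-suc i (allFin m)) ⟩
    p ℕ.* prodℕ (map (p ∷ ps) (without (suc j) (map suc (without i (allFin m)))))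
      ≡⟨ cong (λ xs → p ℕ.* prodℕ (map (p ∷ ps) xs)) (without-suc-map-suc j (without i (allFin m))) ⟩
    p ℕ.* prodℕ (map (p ∷ ps) (map suc (without j (without i (allFin m)))))
      ≡⟨ cong (p ℕ.*_) (prodℕ-map-suc (without j (without i (allFin m)))) ⟩
    p ℕ.* bigMij ps i j ∎

  numeratorP-∷ : numeratorP (p ∷ ps) ≡ ∏mulOneMinus (bigMi ps) (allFin m) (scaledNumeratorP p ps)
  numeratorP-∷ = begin
    ∏mulOneMinus wq (pairsLt (suc m)) base
      ≡⟨ cong (foldr Mq base) (pairsLt-suc m) ⟩
    foldr Mq base (map (λ j → (zero , suc j)) (allFin m) ++ map (Product.map suc suc) (pairsLt m))
      ≡⟨ List.foldr-++ Mq base (map (λ j → (zero , suc j)) (allFin m)) _ ⟩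
    foldr Mq (foldr Mq base (map (Product.map suc suc) (pairsLt m))) (map (λ j → (zero , suc j)) (allFin m))
      ≡⟨ List.foldr-map Mq _ _ (allFin m) ⟩
    foldr (λ j → Mq (zero , suc j)) (foldr Mq base (map (Product.map suc suc) (pairsLt m))) (allFin m)
      ≡⟨ List.foldr-cong (λ j c → cong (λ a → mulOneMinus a c) (bigMij-∷-zero j)) laterPairs (allFin m) ⟩
    ∏mulOneMinus (bigMi ps) (allFin m) (scaledNumeratorP p ps) ∎
    where
    wq : Fin (suc m) × Fin (suc m) → ℕ
    wq ij = bigMij (p ∷ ps) (proj₁ ij) (proj₂ ij)
    Mq : Fin (suc m) × Fin (suc m) → Series → Series
    Mq ij = mulOneMinus (wq ij)
    base : Series
    base = mulOneMinus (bigM (p ∷ ps)) oneS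
    laterPairs : foldr Mq base (map (Product.map suc suc) (pairsLt m)) ≡ scaledNumeratorP p ps
    laterPairs = trans (List.foldr-map Mq (Product.map suc suc) base (pairsLt m))
      (List.foldr-cong (λ ij c → cong (λ a → mulOneMinus a c) (bigMij-∷-suc (proj₁ ij) (proj₂ ij)))
                       (cong (λ a → mulOneMinus a oneS) (bigM-∷)) (pairsLt m))

  seriesP-∷ : seriesP (p ∷ ps) ≡
    divOneMinus (bigM ps) (∏divOneMinus (λ i → p ℕ.* bigMi ps i) (allFin m) (numeratorP (p ∷ ps)))
  seriesP-∷ = begin
    ∏divOneMinus (bigMi (p ∷ ps)) (allFin (suc m)) (numeratorP (p ∷ ps))
      ≡⟨ cong (λ is → ∏divOneMinus (bigMi (p ∷ ps)) is (numeratorP (p ∷ ps))) (allFin-suc m) ⟩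
    divOneMinus (bigMi (p ∷ ps) zero) (∏divOneMinus (bigMi (p ∷ ps)) (map suc (allFin m)) (numeratorP (p ∷ ps)))
      ≡⟨ cong₂ divOneMinus (bigMi-∷-zero) laterFactors ⟩
    divOneMinus (bigM ps) (∏divOneMinus (λ i → p ℕ.* bigMi ps i) (allFin m) (numeratorP (p ∷ ps))) ∎
    where
    laterFactors : ∏divOneMinus (bigMi (p ∷ ps)) (map suc (allFin m)) (numeratorP (p ∷ ps))
                 ≡ ∏divOneMinus (λ i → p ℕ.* bigMi ps i) (allFin m) (numeratorP (p ∷ ps))
    laterFactors = trans (List.foldr-map _ suc _ (allFin m))
      (List.foldr-cong (λ i c → cong (λ a → divOneMinus a c) (bigMi-∷-suc i)) refl (allFin m))

prodℕ-nonZero : ∀ {A : Set} (f : A → ℕ) → (∀ x → NonZero (f x)) → ∀ xs → NonZero (prodℕ (map f xs))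
prodℕ-nonZero f f-nonZero []            = _
prodℕ-nonZero f f-nonZero (x List.∷ xs) = ℕ.m*n≢0 (f x) _ {{f-nonZero x}} {{prodℕ-nonZero f f-nonZero xs}}

module _ {m} (p : ℕ) .{{_ : NonZero p}} (ps : Fin m → ℕ) (ps-nonZero : ∀ i → NonZero (ps i)) where

  private
    bigMi-nonZero : ∀ i → NonZero (bigMi ps i)
    bigMi-nonZero i = prodℕ-nonZero ps ps-nonZero (without i (allFin m))

    p*bigMi-nonZero : ∀ i → NonZero (p ℕ.* bigMi ps i)
    p*bigMi-nonZero i = ℕ.m*n≢0 p (bigMi ps i) {{it}} {{bigMi-nonZero i}}

  stretch-numeratorP : stretch p (numeratorP ps) ≗ scaledNumeratorP p ps
  stretch-numeratorP k = begin
    stretch p (numeratorP ps) k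
      ≡⟨ stretch-∏mulOneMinus _ p (pairsLt m) (mulOneMinus (bigM ps) oneS) k ⟩
    ∏mulOneMinus pNij (pairsLt m) (stretch p (mulOneMinus (bigM ps) oneS)) k
      ≡⟨ ∏mulOneMinus-cong pNij (pairsLt m) stretchedBase k ⟩
    scaledNumeratorP p ps k ∎
    where
    pNij : Fin m × Fin m → ℕ
    pNij ij = p ℕ.* bigMij ps (proj₁ ij) (proj₂ ij)
    stretchedBase : stretch p (mulOneMinus (bigM ps) oneS) ≗ mulOneMinus (p ℕ.* bigM ps) oneS
    stretchedBase k = trans (sym (stretch-mulOneMinus p (bigM ps) oneS k)) (mulOneMinus-cong (p ℕ.* bigM ps) (stretch-oneS p) k)

  mulOneMinus-seriesP-∷ : mulOneMinus (bigM ps) (seriesP (p ∷ ps)) ≗ ∏mulOneMinus (bigMi ps) (allFin m) (stretch p (seriesP ps))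
  mulOneMinus-seriesP-∷ k = begin
    mulOneMinus (bigM ps) (seriesP (p ∷ ps)) k
      ≡⟨ cong (λ s → mulOneMinus (bigM ps) s k) (seriesP-∷ p ps) ⟩
    mulOneMinus (bigM ps) (divOneMinus (bigM ps) (∏divOneMinus pNi (allFin m) (numeratorP (p ∷ ps)))) k
      ≡⟨ mulOneMinus-divOneMinus (bigM ps) {{prodℕ-nonZero ps ps-nonZero (allFin m)}} (∏divOneMinus pNi (allFin m) (numeratorP (p ∷ ps))) k ⟩
    ∏divOneMinus pNi (allFin m) (numeratorP (p ∷ ps)) k
      ≡⟨ cong (λ s → ∏divOneMinus pNi (allFin m) s k) (numeratorP-∷ p ps) ⟩
    ∏divOneMinus pNi (allFin m) (∏mulOneMinus (bigMi ps) (allFin m) (scaledNumeratorP p ps)) k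
      ≡⟨ ∏divOneMinus-∏mulOneMinus-comm pNi p*bigMi-nonZero (bigMi ps) (allFin m) (allFin m) (scaledNumeratorP p ps) k ⟩
    ∏mulOneMinus (bigMi ps) (allFin m) (∏divOneMinus pNi (allFin m) (scaledNumeratorP p ps)) k
      ≡⟨ ∏mulOneMinus-cong (bigMi ps) (allFin m) (∏divOneMinus-cong pNi p*bigMi-nonZero (allFin m) (λ k → sym (stretch-numeratorP k))) k ⟩
    ∏mulOneMinus (bigMi ps) (allFin m) (∏divOneMinus pNi (allFin m) (stretch p (numeratorP ps))) k
      ≡⟨ ∏mulOneMinus-cong (bigMi ps) (allFin m) (λ k → sym (stretch-∏divOneMinus (bigMi ps) bigMi-nonZero p (allFin m) (numeratorP ps) k)) k ⟩
    ∏mulOneMinus (bigMi ps) (allFin m) (stretch p (seriesP ps)) k ∎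
    where
    pNi : Fin m → ℕ
    pNi i = p ℕ.* bigMi ps i

-- Inclusion–exclusion

filter-map : ∀ {A B : Set} {P : B → Set} (P? : ∀ y → Dec (P y)) (f : A → B) xs →
             filter P? (map f xs) ≡ map f (filter (P? ∘ f) xs)
filter-map P? f []            = refl
filter-map P? f (x List.∷ xs) with does (P? (f x))
... | true  = cong (f x List.∷_) (filter-map P? f xs)
... | false = filter-map P? f xs

members : ∀ {m} → Subset m → List (Fin m) → List (Fin m)
members T = filter (λ i → lookup T i Bool.≟ true)

subsetSum : ∀ {m} → (Fin m → ℕ) → Subset m → ℕ
subsetSum {m} w T = foldr ℕ._+_ 0 (map w (members T (allFin m)))

module _ {m} (w : Fin (suc m) → ℕ) (T : Subset m) where

  private
    sumOver : Subset (suc m) → List (Fin (suc m)) → ℕ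
    sumOver T′ is = foldr ℕ._+_ 0 (map w (members T′ is))

    sumOver-map-suc : ∀ b → sumOver (b Vec.∷ T) (map suc (allFin m)) ≡ subsetSum (w ∘ suc) T
    sumOver-map-suc b = cong (foldr ℕ._+_ 0) (trans (cong (map w) (filter-map _ suc (allFin m))) (sym (List.map-∘ _)))

  subsetSum-true : subsetSum w (true Vec.∷ T) ≡ w zero ℕ.+ subsetSum (w ∘ suc) T
  subsetSum-true = trans (cong (sumOver (true Vec.∷ T)) (allFin-suc m)) (cong (w zero ℕ.+_) (sumOver-map-suc true))

  subsetSum-false : subsetSum w (false Vec.∷ T) ≡ subsetSum (w ∘ suc) T
  subsetSum-false = trans (cong (sumOver (false Vec.∷ T)) (allFin-suc m)) (sumOver-map-suc false)

∇-expansion : ∀ m (w : Fin m → ℕ) f x →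
  ∏∇ w (allFin m) f x ≡ sumℤ (map (λ T → signPow ∣ T ∣ * f (x - + subsetSum w T)) (allSubsets m))
∇-expansion zero    w f x = begin
  f x                           ≡⟨ cong f (ℤ.+-identityʳ x) ⟨
  f (x - + 0)                   ≡⟨ ℤ.*-identityˡ (f (x - + 0)) ⟨
  + 1 * f (x - + 0)             ≡⟨ ℤ.+-identityʳ (+ 1 * f (x - + 0)) ⟨
  + 1 * f (x - + 0) + + 0       ∎
∇-expansion (suc m) w f x = begin
  ∏∇ w (allFin (suc m)) f x
    ≡⟨ cong (λ is → ∏∇ w is f x) (allFin-suc m) ⟩
  ∇ (w zero) (∏∇ w (map suc (allFin m)) f) x
    ≡⟨ cong (λ g → ∇ (w zero) g x) (List.foldr-map (λ i → ∇ (w i)) suc f (allFin m)) ⟩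
  G x - G (x - + w zero)
    ≡⟨ cong₂ _-_ (∇-expansion m (w ∘ suc) f x) (∇-expansion m (w ∘ suc) f (x - + w zero)) ⟩
  sumℤ (map (term′ x) S) - sumℤ (map (term′ (x - + w zero)) S)
    ≡⟨ ℤ.+-comm (sumℤ (map (term′ x) S)) _ ⟩
  - sumℤ (map (term′ (x - + w zero)) S) + sumℤ (map (term′ x) S)
    ≡⟨ cong₂ _+_ (trans (sym (sumℤ-map-neg _ S)) (sumℤ-map-cong withFirst S)) (sumℤ-map-cong withoutFirst S) ⟩
  sumℤ (map (term ∘ (true Vec.∷_)) S) + sumℤ (map (term ∘ (false Vec.∷_)) S)
    ≡⟨ cong₂ (λ as bs → sumℤ as + sumℤ bs) (List.map-∘ S) (List.map-∘ S) ⟩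
  sumℤ (map term (map (true Vec.∷_) S)) + sumℤ (map term (map (false Vec.∷_) S))
    ≡⟨ sumℤ-++ (map term (map (true Vec.∷_) S)) _ ⟨
  sumℤ (map term (map (true Vec.∷_) S) ++ map term (map (false Vec.∷_) S))
    ≡⟨ cong sumℤ (List.map-++ term (map (true Vec.∷_) S) _) ⟨
  sumℤ (map term (allSubsets (suc m))) ∎
  where
  S = allSubsets m
  G : ℤ → ℤ
  G = ∏∇ (w ∘ suc) (allFin m) f
  term : Subset (suc m) → ℤ
  term T = signPow ∣ T ∣ * f (x - + subsetSum w T)
  term′ : ℤ → Subset m → ℤ
  term′ y T = signPow ∣ T ∣ * f (y - + subsetSum (w ∘ suc) T)
  withoutFirst : ∀ T → term′ x T ≡ term (false Vec.∷ T)
  withoutFirst T = cong (λ s → signPow ∣ T ∣ * f (x - + s)) (sym (subsetSum-false w T))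
  withFirst : ∀ T → - term′ (x - + w zero) T ≡ term (true Vec.∷ T)
  withFirst T = begin
    - (signPow ∣ T ∣ * f (x - + w zero - + subsetSum (w ∘ suc) T))  ≡⟨ ℤ.neg-distribˡ-* (signPow ∣ T ∣) _ ⟩
    - signPow ∣ T ∣ * f (x - + w zero - + subsetSum (w ∘ suc) T)    ≡⟨ cong (λ y → - signPow ∣ T ∣ * f y) (minus-minus x (+ w zero) _) ⟩
    - signPow ∣ T ∣ * f (x - (+ w zero + + subsetSum (w ∘ suc) T))  ≡⟨ cong (λ s → - signPow ∣ T ∣ * f (x - s)) (ℤ.pos-+ (w zero) _) ⟨
    - signPow ∣ T ∣ * f (x - + (w zero ℕ.+ subsetSum (w ∘ suc) T))  ≡⟨ cong (λ s → - signPow ∣ T ∣ * f (x - + s)) (subsetSum-true w T) ⟨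
    term (true Vec.∷ T)                                              ∎
    where
    minus-minus : ∀ x u v → x - u - v ≡ x - (u + v)
    minus-minus = solve-∀

-- The coefficients of (1 + x^N + ⋯ + x^{(p-1)N}) f.
shiftSum : ℕ → ℕ → (ℤ → ℤ) → ℤ → ℤ
shiftSum p N f x = ∑[ j < p ] f (x - + j * + N)

shiftSum-cong : ∀ p N {f g} → f ≗ g → shiftSum p N f ≗ shiftSum p N g
shiftSum-cong p N f≗g x = ∑<-cong p (λ j → f≗g (x - + j * + N))

shiftSum-∇-telescopes : ∀ p N f x → shiftSum p N (∇ N f) x ≡ f x - f (x - + p * + N)
shiftSum-∇-telescopes p N f x = begin
  ∑[ j < p ] (f (x - + j * + N) - f (x - + j * + N - + N))     ≡⟨ ∑<-cong p (λ j → cong (λ y → f (x - + j * + N) - f y) (step j)) ⟩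
  ∑[ j < p ] (f (x - + j * + N) - f (x - + suc j * + N))       ≡⟨ ∑<-telescope p (λ j → f (x - + j * + N)) ⟩
  f (x - + 0) - f (x - + p * + N)                              ≡⟨ cong (λ y → f y - f (x - + p * + N)) (ℤ.+-identityʳ x) ⟩
  f x - f (x - + p * + N)                                      ∎
  where
  minus-minus : ∀ x j N → x - j * N - N ≡ x - (+ 1 + j) * N
  minus-minus = solve-∀
  step : ∀ j → x - + j * + N - + N ≡ x - + suc j * + N
  step j = trans (minus-minus x (+ j) (+ N)) (cong (λ i → x - i * + N) (ℤ.pos-+ 1 j))

shiftSum-∇-comm : ∀ p N a f → shiftSum p N (∇ a f) ≗ ∇ a (shiftSum p N f)
shiftSum-∇-comm p N a f x = begin
  ∑[ j < p ] (f (x - + j * + N) - f (x - + j * + N - + a))      ≡⟨ ∑<-cong p (λ j → cong (λ y → f (x - + j * + N) - f y) (swap x (+ j * + N) (+ a))) ⟩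
  ∑[ j < p ] (f (x - + j * + N) - f (x - + a - + j * + N))      ≡⟨ sumℤ-map-- (λ j → f (x - + j * + N)) (λ j → f (x - + a - + j * + N)) (upTo p) ⟩
  shiftSum p N f x - shiftSum p N f (x - + a)                    ∎
  where
  swap : ∀ x u v → x - u - v ≡ x - v - u
  swap = solve-∀

shiftSum-∏∇ : ∀ {A : Set} (w : A → ℕ) xs p N f → shiftSum p N (∏∇ w xs f) ≗ ∏∇ w xs (shiftSum p N f)
shiftSum-∏∇ w xs p N f = foldr-fusion-≗ (shiftSum p N) (λ x → ∇-cong (w x)) (λ x → shiftSum-∇-comm p N (w x)) xs f

-- Residues modulo a prime

firstIn-unique : ∀ (P : ℕ → Bool) {j} xs → j ∈ xs → P j ≡ true → (∀ {i} → i ∈ xs → P i ≡ true → i ≡ j) → firstIn P xs ≡ j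
firstIn-unique P (x List.∷ xs) j∈ Pj only with P x in Px
... | true  = only (here refl) Px
... | false with j∈
...   | here refl = contradiction (trans (sym Px) Pj) λ ()
...   | there j∈xs = firstIn-unique P xs j∈xs Pj (only ∘ there)

prime∤⇒coprime : ∀ {p n} → Prime p → ¬ (p ∣ n) → Coprime p n
prime∤⇒coprime p-prime p∤n (d∣p , d∣n) with prime⇒irreducible p-prime d∣p
... | inj₁ d≡1  = d≡1
... | inj₂ refl = contradiction d∣n p∤n

module _ {p N} (p-prime : Prime p) (p∤N : ¬ (p ∣ N)) where

  private
    instance
      p-nonZero : NonZero p
      p-nonZero = prime⇒nonZero p-prime

    lift : ∀ a b c d → 1 ℕ.+ a ℕ.* b ≡ c ℕ.* d → + 1 + + a * + b ≡ + c * + d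
    lift a b c d eq = trans (cong (_+_ (+ 1)) (sym (ℤ.pos-* a b))) (trans (cong +_ eq) (ℤ.pos-* c d))

  N-invertible : ∃[ U ] (+ p ∣ℤ U * + N - + 1)
  N-invertible with coprime-Bézout (prime∤⇒coprime p-prime p∤N)
  ... | Bézout.+- x y 1+yN≡xp = - + y , divides (- + x) (begin
    - + y * + N - + 1        ≡⟨ negate (+ y) (+ N) ⟩
    - (+ 1 + + y * + N)      ≡⟨ cong -_ (lift y N x p 1+yN≡xp) ⟩
    - (+ x * + p)            ≡⟨ ℤ.neg-distribˡ-* (+ x) (+ p) ⟩
    - + x * + p              ∎)
    where
    negate : ∀ y N → - y * N - + 1 ≡ - (+ 1 + y * N)
    negate = solve-∀
  ... | Bézout.-+ x y 1+xp≡yN = + y , divides (+ x) (begin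
    + y * + N - + 1          ≡⟨ cong (_- + 1) (lift x p y N 1+xp≡yN) ⟨
    + 1 + + x * + p - + 1    ≡⟨ cancel (+ x * + p) ⟩
    + x * + p                ∎)
    where
    cancel : ∀ u → + 1 + u - + 1 ≡ u
    cancel = solve-∀

  private
    residue-index-unique-≤ : ∀ k {i j} → i ≤ j → j < p → + p ∣ℤ k - + i * + N → + p ∣ℤ k - + j * + N → i ≡ j
    residue-index-unique-≤ k {i} {j} i≤j j<p p∣i p∣j = ℕ.≤-antisym i≤j (ℕ.m∸n≡0⇒m≤n gap≡0)
      where
      difference : ∀ k i j N → (k - i * N) - (k - j * N) ≡ (j - i) * N
      difference = solve-∀
      gap : (k - + i * + N) - (k - + j * + N) ≡ + ((j ℕ.∸ i) ℕ.* N)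
      gap = begin
        (k - + i * + N) - (k - + j * + N) ≡⟨ difference k (+ i) (+ j) (+ N) ⟩
        (+ j - + i) * + N                 ≡⟨ cong (_* + N) (trans (ℤ.[+m]-[+n]≡m⊖n j i) (ℤ.⊖-≥ i≤j)) ⟩
        + (j ℕ.∸ i) * + N                 ≡⟨ ℤ.pos-* (j ℕ.∸ i) N ⟨
        + ((j ℕ.∸ i) ℕ.* N)               ∎
      p∣N·gap : p ∣ N ℕ.* (j ℕ.∸ i)
      p∣N·gap = subst (p ∣_) (ℕ.*-comm (j ℕ.∸ i) N) (ℤ∣.∣⇒∣ᵤ (subst (+ p ∣ℤ_) gap (ℤ∣.∣m∣n⇒∣m-n p∣i p∣j)))
      gap≡0 : j ℕ.∸ i ≡ 0
      gap≡0 = multiple-below-zero (ℕ.≤-<-trans (ℕ.m∸n≤m j i) j<p) (coprime-divisor (prime∤⇒coprime p-prime p∤N) p∣N·gap)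

  residue-index-unique : ∀ k {j₁ j₂} → j₁ < p → j₂ < p → + p ∣ℤ k - + j₁ * + N → + p ∣ℤ k - + j₂ * + N → j₁ ≡ j₂
  residue-index-unique k {j₁} {j₂} j₁<p j₂<p p∣₁ p∣₂ with ℕ.≤-total j₁ j₂
  ... | inj₁ j₁≤j₂ = residue-index-unique-≤ k j₁≤j₂ j₂<p p∣₁ p∣₂
  ... | inj₂ j₂≤j₁ = sym (residue-index-unique-≤ k j₂≤j₁ j₁<p p∣₂ p∣₁)

  -- If U N ≡ 1 (mod p), then j = kU mod p works.
  residue-index-exists : ∀ k → ∃[ j ] (j < p × + p ∣ℤ k - + j * + N)
  residue-index-exists k with N-invertible
  ... | U , divides t UN-1≡tp = j , n%ℕd<d (k * U) p , divides (s * + N - k * t) (begin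
    k - + j * + N                                       ≡⟨ cong (λ r → k - r * + N) j≡kU-sp ⟩
    k - (k * U - s * + p) * + N                         ≡⟨ expand k U s t (+ N) (+ p) ⟩
    (s * + N - k * t) * + p + k * (t * + p - (U * + N - + 1)) ≡⟨ cong (λ e → (s * + N - k * t) * + p + k * (t * + p - e)) UN-1≡tp ⟩
    (s * + N - k * t) * + p + k * (t * + p - t * + p)   ≡⟨ vanish ((s * + N - k * t) * + p) k (t * + p) ⟩
    (s * + N - k * t) * + p                             ∎)
    where
    j = (k * U) %ℕ p
    s = (k * U) /ℕ p
    expand : ∀ k U s t N p → k - (k * U - s * p) * N ≡ (s * N - k * t) * p + k * (t * p - (U * N - + 1))
    expand = solve-∀
    vanish : ∀ a k u → a + k * (u - u) ≡ a
    vanish = solve-∀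
    j≡kU-sp : + j ≡ k * U - s * + p
    j≡kU-sp = trans (sym (m+n-n≡m (+ j) (s * + p))) (cong (_- s * + p) (sym (a≡a%ℕn+[a/ℕn]*n (k * U) p)))

  bracket-residue-index : ∀ k {j} → j < p → + p ∣ℤ k - + j * + N → bracket k N p ≡ j
  bracket-residue-index k {j} j<p p∣k-jN = firstIn-unique _ (upTo p) (∈-upTo⁺ j<p)
    (divides?-complete (+ j * + N - k) p (∣-minus-comm {a = k} p∣k-jN))
    (λ {i} i∈ holds → residue-index-unique k (∈-upTo⁻ i∈) j<p (∣-minus-comm {a = + i * + N} (divides?-sound (+ i * + N - k) p holds)) p∣k-jN)

  mK-quotient : ∀ k {j t} → j < p → k - + j * + N ≡ t * + p → mK p N k ≡ t
  mK-quotient k {j} {t} j<p k-jN≡tp = begin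
    divExact (k - + N * + bracket k N p) p ≡⟨ cong (λ b → divExact (k - + N * + b) p) (bracket-residue-index k j<p (divides t k-jN≡tp)) ⟩
    divExact (k - + N * + j) p             ≡⟨ cong (λ y → divExact (k - y) p) (ℤ.*-comm (+ N) (+ j)) ⟩
    divExact (k - + j * + N) p             ≡⟨ cong (λ y → divExact y p) k-jN≡tp ⟩
    divExact (t * + p) p                   ≡⟨ divExact-multiple t p ⟩
    t                                      ∎

  shiftSum-stretch : ∀ c k → shiftSum p N (coeffℤ (stretch p c)) k ≡ coeffℤ c (mK p N k)
  shiftSum-stretch c k = viaResidueIndex (residue-index-exists k)
    where
    viaResidueIndex : ∃[ j ] (j < p × + p ∣ℤ k - + j * + N) → shiftSum p N (coeffℤ (stretch p c)) k ≡ coeffℤ c (mK p N k)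
    viaResidueIndex (j , j<p , divides t k-jN≡tp) = begin
      ∑[ i < p ] coeffℤ (stretch p c) (k - + i * + N) ≡⟨ ∑<-single p j j<p others ⟩
      coeffℤ (stretch p c) (k - + j * + N)            ≡⟨ cong (coeffℤ (stretch p c)) k-jN≡tp ⟩
      coeffℤ (stretch p c) (t * + p)                  ≡⟨ coeffℤ-stretch-multiple p c t ⟩
      coeffℤ c t                                      ≡⟨ cong (coeffℤ c) (mK-quotient k {t = t} j<p k-jN≡tp) ⟨
      coeffℤ c (mK p N k)                             ∎
      where
      others : ∀ i → i < p → i ≢ j → coeffℤ (stretch p c) (k - + i * + N) ≡ + 0
      others i i<p i≢j = coeffℤ-stretch-nonmultiple p c λ p∣k-iN →
        i≢j (residue-index-unique k i<p j<p p∣k-iN (divides t k-jN≡tp))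

coeffA≗coeffℤ : ∀ {m} (q : Fin m → ℕ) → coeffA q ≗ coeffℤ (seriesP q)
coeffA≗coeffℤ q (+ k)    = refl
coeffA≗coeffℤ q -[1+ _ ] = refl

mainTheorem12 : (n : ℕ) → (ps : Fin (suc n) → ℕ) → (∀ i → Prime (ps i)) → Injective _≡_ _≡_ ps
  → (p : ℕ) → Prime p → ¬ (p ∣ bigM ps) → (k : ℤ)
  → coeffA (p ∷ ps) k - coeffA (p ∷ ps) (k - (+ p) * (+ bigM ps))
    ≡ sumℤ (map (λ T → signPow ∣ T ∣ * coeffA ps (mK p (bigM ps) (k - + bigNT ps T))) (allSubsets (suc n)))
mainTheorem12 n ps ps-prime _ p p-prime p∤N k = begin
  coeffA (p ∷ ps) k - coeffA (p ∷ ps) (k - + p * + N)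
    ≡⟨ cong₂ _-_ (coeffA≗coeffℤ (p ∷ ps) k) (coeffA≗coeffℤ (p ∷ ps) (k - + p * + N)) ⟩
  coeffℤ L k - coeffℤ L (k - + p * + N)
    ≡⟨ shiftSum-∇-telescopes p N (coeffℤ L) k ⟨
  shiftSum p N (∇ N (coeffℤ L)) k
    ≡⟨ shiftSum-cong p N (λ x → trans (sym (coeffℤ-mulOneMinus N L x)) (coeffℤ-cong (mulOneMinus-seriesP-∷ p ps ps-nonZero) x)) k ⟩
  shiftSum p N (coeffℤ (∏mulOneMinus Ni (allFin (suc n)) (stretch p R))) k
    ≡⟨ shiftSum-cong p N (coeffℤ-∏mulOneMinus Ni (allFin (suc n)) (stretch p R)) k ⟩
  shiftSum p N (∏∇ Ni (allFin (suc n)) (coeffℤ (stretch p R))) k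
    ≡⟨ shiftSum-∏∇ Ni (allFin (suc n)) p N (coeffℤ (stretch p R)) k ⟩
  ∏∇ Ni (allFin (suc n)) (shiftSum p N (coeffℤ (stretch p R))) k
    ≡⟨ ∏∇-cong Ni (allFin (suc n)) (λ x → trans (shiftSum-stretch p-prime p∤N R x) (sym (coeffA≗coeffℤ ps (mK p N x)))) k ⟩
  ∏∇ Ni (allFin (suc n)) (coeffA ps ∘ mK p N) k
    ≡⟨ ∇-expansion (suc n) Ni (coeffA ps ∘ mK p N) k ⟩
  sumℤ (map (λ T → signPow ∣ T ∣ * coeffA ps (mK p N (k - + bigNT ps T))) (allSubsets (suc n))) ∎
  where
  instance
    p-nonZero : NonZero p
    p-nonZero = prime⇒nonZero p-prime
  ps-nonZero : ∀ i → NonZero (ps i)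
  ps-nonZero i = prime⇒nonZero (ps-prime i)
  N = bigM ps
  Ni = bigMi ps
  L = seriesP (p ∷ ps)
  R = seriesP ps
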